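{- The smallest positive integer $n$ for which $\Psi_n(x)$ is not flat is $n=561$.
   Context: $\Psi_n(x)=(x^n-1)/\Phi_n(x)\in\mathbb Z[x]$, where $\Phi_n$ is the $n$-th cyclotomic polynomial. A polynomial in $\mathbb Z[x]$ is flat if the maximum absolute value of its coefficients equals $1$. -}

module Defs where

open import Data.Nat as ℕ using (ℕ; zero; suc; _⊔_; _<_)
open import Data.Nat.Divisibility using (_∣?_)
open import Data.Integer as ℤ using (ℤ; +_; ∣_∣)
open import Data.List using (List; []; _∷_; map; foldr; replicate; reverse; length; filter; upTo; [_]; _++_)
open import Relation.Nullary using (yes; no)
open import Relation.Binary.PropositionalEquality using (_≡_)

-- Polynomials over ℤ as coefficient lists, lowest degree first:
-- a₀ ∷ a₁ ∷ … ∷ aₖ ∷ []  represents  a₀ + a₁ x + … + aₖ xᵏ.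
Poly : Set
Poly = List ℤ

_+ₚ_ : Poly → Poly → Poly
[] +ₚ q = q
(a ∷ p) +ₚ [] = a ∷ p
(a ∷ p) +ₚ (b ∷ q) = (a ℤ.+ b) ∷ (p +ₚ q)

_*ₚ_ : Poly → Poly → Poly
[] *ₚ q = []
(a ∷ p) *ₚ q = map (a ℤ.*_) q +ₚ ((+ 0) ∷ (p *ₚ q))

prodₚ : List Poly → Poly
prodₚ = foldr _*ₚ_ ((+ 1) ∷ [])

xⁿ-1 : ℕ → Poly
xⁿ-1 zero = []
xⁿ-1 (suc m) = ℤ.-[1+ 0 ] ∷ (replicate m (+ 0) ++ [ + 1 ])

-- Long division by a monic divisor, on highest-degree-first lists.
private
  subScaled : List ℤ → ℤ → List ℤ → List ℤ
  subScaled [] c _ = []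
  subScaled rs c [] = rs
  subScaled (r ∷ rs) c (b ∷ bs) = (r ℤ.- c ℤ.* b) ∷ subScaled rs c bs

  divH : ℕ → List ℤ → List ℤ → List ℤ
  divH zero a b = []
  divH (suc f) a [] = []
  divH (suc f) [] (_ ∷ bt) = []
  divH (suc f) (c ∷ rest) (b ∷ bt) with length (b ∷ bt) ℕ.≤? length (c ∷ rest)
  ... | no _ = []
  ... | yes _ = c ∷ divH f (subScaled rest c bt) (b ∷ bt)

-- Quotient of p by a monic polynomial q (q without trailing zero coefficients).
_divₚ_ : Poly → Poly → Poly
p divₚ q = reverse (divH (length p) (reverse p) (reverse q))

properDivisors : ℕ → List ℕ
properDivisors n = filter (_∣? n) (upTo n)

-- Cyclotomic polynomials, via the defining recursion
--   x^n - 1 = ∏_{d ∣ n} Φ_d ,  i.e.  Φ_n = (x^n - 1) / ∏_{d ∣ n, d < n} Φ_d .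
-- (fuel f ≥ n guarantees termination)
private
  cycF : ℕ → ℕ → Poly
  cycF zero n = []
  cycF (suc f) n = xⁿ-1 n divₚ prodₚ (map (cycF f) (properDivisors n))

Φ : ℕ → Poly
Φ n = cycF n n

Ψ : ℕ → Poly
Ψ n = xⁿ-1 n divₚ Φ n

height : Poly → ℕ
height p = foldr _⊔_ 0 (map ∣_∣ p)

Flat : Poly → Set
Flat p = height p ≡ 1

{-# OPTIONS --safe #-}
module Submission where

open import Defs
open import Data.Nat using (ℕ; suc; _≤_; _<_; _≟_; s≤s)
open import Data.Nat.Properties using (allUpTo?)
open import Data.Product using (_×_; _,_)
open import Relation.Nullary using (¬_; Dec)
open import Relation.Nullary.Decidable using (toWitness; toWitnessFalse)

flat? : (p : Poly) → Dec (Flat p)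
flat? p = height p ≟ 1

Ψ-flat-below-561 : ∀ {m} → m < 560 → Flat (Ψ (suc m))
Ψ-flat-below-561 = toWitness {a? = allUpTo? (λ m → flat? (Ψ (suc m))) 560} _

Ψ561-not-flat : ¬ Flat (Ψ 561)
Ψ561-not-flat = toWitnessFalse {a? = flat? (Ψ 561)} _

lemma12 : (¬ Flat (Ψ 561)) × ((n : ℕ) → 1 ≤ n → n < 561 → Flat (Ψ n))
lemma12 = Ψ561-not-flat , λ { (suc m) _ (s≤s m<560) → Ψ-flat-below-561 m<560 }
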